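{- Let $G$ be a graph and let $K,K'$ be vertex sets of size $k$ such that the induced subgraphs $F=G[K]$ and $F'=G[K']$ both lie in $\mathcal{F}_k$, witnessed respectively by partitions $K=A\cup B$, $A=A_1\cup\dots\cup A_r$ and $K'=A'\cup B'$, $A'=A'_1\cup\dots\cup A'_r$. If $|K\cap K'|\ge(1-10a_p)k$, then: (1) a vertex $v\in K\cap K'$ lies in $A$ if and only if it lies in $A'$; (2) for $u,v\in A\cap A'$, the vertices $u,v$ form one of the pairs $A_j$ if and only if they form one of the pairs $A'_j$.
   Context: $a_p$ is a positive constant with $a_p<0.01$, and $r=a_pk/2$ (floors/ceilings ignored). A graph $F$ on a $k$-vertex set is in $\mathcal{F}_k$ if there is a partition of its vertex set into $A$ and $B$ with $|A|=a_pk$, $|B|=(1-a_p)k$, and a partition of $A$ into $r$ pairs $A_1,\dots,A_r$, such that: $F$ is bipartite with parts $A,B$ (no edges inside $A$ or inside $B$); every $\beta\in B$ is adjacent to both or neither of the vertices of each $A_i$; every vertex of $A$ has degree at least $0.15k$; and for $i\neq j$ the symmetric difference of the neighborhoods of $A_i$ and $A_j$ has size at least $0.25k$. -}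

module Defs where

open import Data.Nat using (ℕ; _+_; _*_; _∸_; _≤_)
open import Data.Bool using (Bool; true; false; _∧_; _∨_)
open import Data.Fin using (Fin; zero; suc)
open import Data.Fin.Subset using (Subset; _∈_; _∩_; _∪_; ∁; ⁅_⁆; ∣_∣; ⊥; _⊆_)
open import Data.Vec using (tabulate; lookup)
open import Data.Product using (Σ; ∃; _×_)
open import Relation.Binary.PropositionalEquality using (_≡_; _≢_)

record Graph (n : ℕ) : Set where
  field
    Adj   : Fin n → Fin n → Bool
    sym   : ∀ u v → Adj u v ≡ Adj v u
    loopless : ∀ v → Adj v v ≡ false
open Graph public

anyFin : ∀ {n} → (Fin n → Bool) → Bool
anyFin {ℕ.zero} f = false
anyFin {ℕ.suc n} f = f zero ∨ anyFin (λ i → f (suc i))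

nbhd : ∀ {n} → Graph n → Subset n → Fin n → Subset n
nbhd G K v = tabulate (λ u → lookup K u ∧ Adj G v u)

nbhdSet : ∀ {n} → Graph n → Subset n → Subset n → Subset n
nbhdSet G K S = tabulate (λ u → lookup K u ∧ anyFin (λ v → lookup S v ∧ Adj G v u))

_△_ : ∀ {n} → Subset n → Subset n → Subset n
X △ Y = (X ∩ ∁ Y) ∪ (Y ∩ ∁ X)

-- Parameters: a_p k = |A| = 2r, i.e. a_p = 2r/k (floors ignored, a_p k an even integer).
-- A witness that G[K] lies in 𝓕_k, with constants cleared of denominators:
--   deg ≥ 0.15k  ⇔ 20·deg ≥ 3k ;  |symdiff| ≥ 0.25k ⇔ 4·|symdiff| ≥ k.
record InFk {n : ℕ} (G : Graph n) (k r : ℕ) (K : Subset n) : Set where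
  field
    A B       : Subset n
    AB-disj   : A ∩ B ≡ ⊥
    AB-cover  : A ∪ B ≡ K
    size-A    : ∣ A ∣ ≡ 2 * r
    size-B    : ∣ B ∣ ≡ k ∸ 2 * r
    pair      : Fin r → Subset n
    pair-size : ∀ i → ∣ pair i ∣ ≡ 2
    pair-⊆    : ∀ i → pair i ⊆ A
    pair-disj : ∀ i j → i ≢ j → pair i ∩ pair j ≡ ⊥
    pair-cover : ∀ v → v ∈ A → ∃ λ i → v ∈ pair i
    A-indep   : ∀ u v → u ∈ A → v ∈ A → Adj G u v ≡ false
    B-indep   : ∀ u v → u ∈ B → v ∈ B → Adj G u v ≡ false
    B-uniform : ∀ i β u v → β ∈ B → u ∈ pair i → v ∈ pair i → Adj G β u ≡ Adj G β v
    A-degree  : ∀ v → v ∈ A → 3 * k ≤ 20 * ∣ nbhd G K v ∣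
    pair-far  : ∀ i j → i ≢ j → k ≤ 4 * ∣ nbhdSet G K (pair i) △ nbhdSet G K (pair j) ∣
open InFk public

IsPair : ∀ {n} {G : Graph n} {k r : ℕ} {K : Subset n} → InFk G k r K → Fin n → Fin n → Set
IsPair W u v = ∃ λ i → pair W i ≡ ⁅ u ⁆ ∪ ⁅ v ⁆

{-# OPTIONS --safe #-}
-- A vertex of A with at least 0.15k neighbours cannot lie in B' : its neighbours in K' would all
-- lie in A', so it has at most |A'| + |K ∖ K'| ≤ 11 a_p k < 0.15k neighbours. Next let u, v ∈ A ∩ A' with {u, v} = A_j, and say u ∈ A'_i, v ∈ A'_l. A common vertex x
-- adjacent to A'_i lies in B', hence is adjacent to u ∈ A, hence lies in B and is adjacent to v,
-- so lies in N(A'_l). Thus the neighbourhoods of A'_i and A'_l differ only outside K, in at most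
-- 10 a_p k < 0.25k vertices, which forces i = l.
module Submission where

open import Defs hiding (sym)
open import Data.Nat using (ℕ; zero; suc; _+_; _*_; _≤_; _<_; s≤s; z≤n)
open import Data.Nat.Properties
open import Data.Nat.Tactic.RingSolver using (solve-∀)
open import Data.Bool using (Bool; true; false; _∧_)
open import Data.Vec using (_∷_; []; lookup; tabulate)
open import Data.Vec.Properties using ([]=⇒lookup; lookup⇒[]=; lookup∘tabulate)
open import Data.Fin using (Fin)
import Data.Fin.Properties as Fin
open import Data.Fin.Subset using (Subset; _∈_; _∉_; _∩_; _∪_; ∁; ⁅_⁆; ∣_∣; _⊆_)
open import Data.Fin.Subset.Properties
open import Data.Product using (_×_; ∃; _,_)
open import Data.Sum using (_⊎_; inj₁; inj₂; [_,_])
open import Function using (_∘_)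
open import Function.Bundles using (_⇔_; mk⇔)
open import Relation.Nullary using (yes; no; contradiction)
open import Relation.Binary.PropositionalEquality
  using (_≡_; _≢_; refl; sym; trans; cong; subst; module ≡-Reasoning)

private
  variable
    n : ℕ
    p q s : Subset n
    x y u v : Fin n

∣p∪q∣≤∣p∣+∣q∣ : ∀ (p q : Subset n) → ∣ p ∪ q ∣ ≤ ∣ p ∣ + ∣ q ∣
∣p∪q∣≤∣p∣+∣q∣ []          []          = z≤n
∣p∪q∣≤∣p∣+∣q∣ (true ∷ p)  (true ∷ q)  = s≤s (≤-trans (∣p∪q∣≤∣p∣+∣q∣ p q) (+-monoʳ-≤ ∣ p ∣ (n≤1+n ∣ q ∣)))
∣p∪q∣≤∣p∣+∣q∣ (true ∷ p)  (false ∷ q) = s≤s (∣p∪q∣≤∣p∣+∣q∣ p q)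
∣p∪q∣≤∣p∣+∣q∣ (false ∷ p) (true ∷ q)  = subst (suc ∣ p ∪ q ∣ ≤_) (sym (+-suc ∣ p ∣ ∣ q ∣)) (s≤s (∣p∪q∣≤∣p∣+∣q∣ p q))
∣p∪q∣≤∣p∣+∣q∣ (false ∷ p) (false ∷ q) = ∣p∪q∣≤∣p∣+∣q∣ p q

∣p∩q∣+∣p∩∁q∣≡∣p∣ : ∀ (p q : Subset n) → ∣ p ∩ q ∣ + ∣ p ∩ ∁ q ∣ ≡ ∣ p ∣
∣p∩q∣+∣p∩∁q∣≡∣p∣ []          []          = refl
∣p∩q∣+∣p∩∁q∣≡∣p∣ (true ∷ p)  (true ∷ q)  = cong suc (∣p∩q∣+∣p∩∁q∣≡∣p∣ p q)
∣p∩q∣+∣p∩∁q∣≡∣p∣ (true ∷ p)  (false ∷ q) = trans (+-suc ∣ p ∩ q ∣ ∣ p ∩ ∁ q ∣) (cong suc (∣p∩q∣+∣p∩∁q∣≡∣p∣ p q))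
∣p∩q∣+∣p∩∁q∣≡∣p∣ (false ∷ p) (true ∷ q)  = ∣p∩q∣+∣p∩∁q∣≡∣p∣ p q
∣p∩q∣+∣p∩∁q∣≡∣p∣ (false ∷ p) (false ∷ q) = ∣p∩q∣+∣p∩∁q∣≡∣p∣ p q

∣p∣≤∣p∩q∣+m⇒∣p∩∁q∣≤m : ∀ (p q : Subset n) {m} → ∣ p ∣ ≤ ∣ p ∩ q ∣ + m → ∣ p ∩ ∁ q ∣ ≤ m
∣p∣≤∣p∩q∣+m⇒∣p∩∁q∣≤m p q {m} h = +-cancelˡ-≤ ∣ p ∩ q ∣ ∣ p ∩ ∁ q ∣ m
  (subst (_≤ ∣ p ∩ q ∣ + m) (sym (∣p∩q∣+∣p∩∁q∣≡∣p∣ p q)) h)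

p∩∁q⊆s⇒q∩∁p⊆s⇒p△q⊆s : p ∩ ∁ q ⊆ s → q ∩ ∁ p ⊆ s → p △ q ⊆ s
p∩∁q⊆s⇒q∩∁p⊆s⇒p△q⊆s {p = p} {q} p∖q⊆s q∖p⊆s = [ p∖q⊆s , q∖p⊆s ] ∘ x∈p∪q⁻ (p ∩ ∁ q) (q ∩ ∁ p)

1<∣⁅x⁆∪⁅y⁆∣ : x ≢ y → 1 < ∣ ⁅ x ⁆ ∪ ⁅ y ⁆ ∣
1<∣⁅x⁆∪⁅y⁆∣ {x = x} {y} x≢y = subst (_< ∣ ⁅ x ⁆ ∪ ⁅ y ⁆ ∣) (∣⁅x⁆∣≡1 x)
  (p⊂q⇒∣p∣<∣q∣ (p⊆p∪q ⁅ y ⁆ , y , x∈p∪q⁺ (inj₂ (x∈⁅x⁆ y)) , x≢y⇒x∉⁅y⁆ (x≢y ∘ sym)))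

∣⁅x⁆∪⁅y⁆∣≡2⇒x≢y : ∣ ⁅ x ⁆ ∪ ⁅ y ⁆ ∣ ≡ 2 → x ≢ y
∣⁅x⁆∪⁅y⁆∣≡2⇒x≢y {x = x} e refl with trans (sym (∣⁅x⁆∣≡1 x)) (trans (cong ∣_∣ (sym (∪-idem ⁅ x ⁆))) e)
... | ()

∣p∣≡2⇒p≡⁅x⁆∪⁅y⁆ : ∣ p ∣ ≡ 2 → x ∈ p → y ∈ p → x ≢ y → p ≡ ⁅ x ⁆ ∪ ⁅ y ⁆
∣p∣≡2⇒p≡⁅x⁆∪⁅y⁆ {p = p} {x} {y} ∣p∣≡2 x∈p y∈p x≢y = ⊆-antisym p⊆xy xy⊆p
  where
  xy⊆p : ⁅ x ⁆ ∪ ⁅ y ⁆ ⊆ p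
  xy⊆p z∈xy with x∈p∪q⁻ ⁅ x ⁆ ⁅ y ⁆ z∈xy
  ... | inj₁ z∈⁅x⁆ = subst (_∈ p) (sym (x∈⁅y⁆⇒x≡y x z∈⁅x⁆)) x∈p
  ... | inj₂ z∈⁅y⁆ = subst (_∈ p) (sym (x∈⁅y⁆⇒x≡y y z∈⁅y⁆)) y∈p
  p⊆xy : p ⊆ ⁅ x ⁆ ∪ ⁅ y ⁆
  p⊆xy {z} z∈p with z ∈? ⁅ x ⁆ ∪ ⁅ y ⁆
  ... | yes z∈xy = z∈xy
  ... | no  z∉xy = contradiction (1<∣⁅x⁆∪⁅y⁆∣ x≢y)
    (<⇒≱ (subst (_ <_) ∣p∣≡2 (p⊂q⇒∣p∣<∣q∣ (xy⊆p , z , z∈p , z∉xy))))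

∈-tabulate⁻ : ∀ {f : Fin n → Bool} → x ∈ tabulate f → f x ≡ true
∈-tabulate⁻ {x = x} {f} x∈ = trans (sym (lookup∘tabulate f x)) ([]=⇒lookup x∈)

∈-tabulate⁺ : ∀ {f : Fin n → Bool} → f x ≡ true → x ∈ tabulate f
∈-tabulate⁺ {x = x} {f} fx = lookup⇒[]= x (tabulate f) (trans (lookup∘tabulate f x) fx)

∧≡true⁻ : ∀ {a b : Bool} → a ∧ b ≡ true → a ≡ true × b ≡ true
∧≡true⁻ {true} {true} refl = refl , refl

anyFin≡true⁻ : ∀ (f : Fin n → Bool) → anyFin f ≡ true → ∃ λ i → f i ≡ true
anyFin≡true⁻ {zero}  f ()
anyFin≡true⁻ {suc n} f any with f Fin.zero in fzero
... | true  = Fin.zero , fzero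
... | false with anyFin≡true⁻ (f ∘ Fin.suc) any
...   | i , fi = Fin.suc i , fi

anyFin≡true⁺ : ∀ (f : Fin n → Bool) i → f i ≡ true → anyFin f ≡ true
anyFin≡true⁺ f Fin.zero    fi rewrite fi = refl
anyFin≡true⁺ f (Fin.suc i) fi with f Fin.zero
... | true  = refl
... | false = anyFin≡true⁺ (f ∘ Fin.suc) i fi

module _ {G : Graph n} {K : Subset n} where

  ∈-nbhd⁻ : y ∈ nbhd G K x → y ∈ K × Adj G x y ≡ true
  ∈-nbhd⁻ y∈ with ∧≡true⁻ (∈-tabulate⁻ y∈)
  ... | y∈K , xy = lookup⇒[]= _ K y∈K , xy

  ∈-nbhdSet⁻ : y ∈ nbhdSet G K s → y ∈ K × ∃ λ x → x ∈ s × Adj G x y ≡ true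
  ∈-nbhdSet⁻ {s = s} y∈ with ∧≡true⁻ (∈-tabulate⁻ y∈)
  ... | y∈K , any with anyFin≡true⁻ _ any
  ...   | x , sx∧xy with ∧≡true⁻ sx∧xy
  ...     | x∈s , xy = lookup⇒[]= _ K y∈K , x , lookup⇒[]= x s x∈s , xy

  ∈-nbhdSet⁺ : y ∈ K → x ∈ s → Adj G x y ≡ true → y ∈ nbhdSet G K s
  ∈-nbhdSet⁺ {y = y} {x} {s} y∈K x∈s xy = ∈-tabulate⁺
    (subst (λ b → b ∧ _ ≡ true) (sym ([]=⇒lookup y∈K))
      (anyFin≡true⁺ (λ z → lookup s z ∧ Adj G z y) x
        (subst (λ b → b ∧ Adj G x y ≡ true) (sym ([]=⇒lookup x∈s)) xy)))

true≢false : ∀ {b : Bool} → b ≡ true → b ≢ false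
true≢false refl ()

module _ {G : Graph n} {k r : ℕ} {K : Subset n} (W : InFk G k r K) where

  ∈K⇒∈A⊎∈B : x ∈ K → x ∈ A W ⊎ x ∈ B W
  ∈K⇒∈A⊎∈B x∈K = x∈p∪q⁻ (A W) (B W) (subst (_ ∈_) (sym (AB-cover W)) x∈K)

  adjacent-to-A⇒∈B : y ∈ K → x ∈ A W → Adj G x y ≡ true → y ∈ B W
  adjacent-to-A⇒∈B y∈K x∈A xy with ∈K⇒∈A⊎∈B y∈K
  ... | inj₁ y∈A = contradiction (A-indep W _ _ x∈A y∈A) (true≢false xy)
  ... | inj₂ y∈B = y∈B

  adjacent-to-B⇒∈A : y ∈ K → x ∈ B W → Adj G x y ≡ true → y ∈ A W
  adjacent-to-B⇒∈A y∈K x∈B xy with ∈K⇒∈A⊎∈B y∈K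
  ... | inj₁ y∈A = y∈A
  ... | inj₂ y∈B = contradiction (B-indep W _ _ x∈B y∈B) (true≢false xy)

  adjacent-to-pair : ∀ {i} → y ∈ K → x ∈ pair W i → Adj G x y ≡ true →
    u ∈ pair W i → Adj G u y ≡ true
  adjacent-to-pair {y = y} {x} {u} {i} y∈K x∈i xy u∈i = begin
    Adj G u y ≡⟨ Graph.sym G u y ⟩
    Adj G y u ≡⟨ B-uniform W i y u x y∈B u∈i x∈i ⟩
    Adj G y x ≡⟨ Graph.sym G y x ⟩
    Adj G x y ≡⟨ xy ⟩
    true      ∎
    where
    open ≡-Reasoning
    y∈B = adjacent-to-A⇒∈B y∈K (pair-⊆ W i x∈i) xy

  nbhd-of-B⊆A∪outside : ∀ (L : Subset n) → x ∈ B W → nbhd G L x ⊆ A W ∪ (L ∩ ∁ K)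
  nbhd-of-B⊆A∪outside {x = x} L x∈B {y} y∈N with ∈-nbhd⁻ {G = G} {K = L} {x = x} y∈N
  ... | y∈L , xy with y ∈? K
  ...   | yes y∈K = x∈p∪q⁺ (inj₁ (adjacent-to-B⇒∈A y∈K x∈B xy))
  ...   | no  y∉K = x∈p∪q⁺ (inj₂ (x∈p∩q⁺ (y∈L , x∉p⇒x∈∁p y∉K)))

  ∣nbhd-of-B∣≤ : ∀ (L : Subset n) → x ∈ B W → ∣ nbhd G L x ∣ ≤ 2 * r + ∣ L ∩ ∁ K ∣
  ∣nbhd-of-B∣≤ L x∈B = ≤-trans (p⊆q⇒∣p∣≤∣q∣ (nbhd-of-B⊆A∪outside L x∈B))
    (≤-trans (∣p∪q∣≤∣p∣+∣q∣ (A W) (L ∩ ∁ K)) (≤-reflexive (cong (_+ _) (size-A W))))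

degree-bound-violated : ∀ r k → 200 * r < k → 20 * (2 * r + 20 * r) < 3 * k
degree-bound-violated r k 200r<k = begin-strict
  20 * (2 * r + 20 * r) ≡⟨ normalise r ⟩
  440 * r               ≤⟨ *-monoˡ-≤ r (m≤m+n 440 160) ⟩
  600 * r               ≡⟨ *-assoc 3 200 r ⟩
  3 * (200 * r)         <⟨ *-monoʳ-< 3 200r<k ⟩
  3 * k                 ∎
  where
  open ≤-Reasoning
  normalise : ∀ r → 20 * (2 * r + 20 * r) ≡ 440 * r
  normalise = solve-∀

far-bound-violated : ∀ r k → 200 * r < k → 4 * (20 * r) < k
far-bound-violated r k 200r<k = begin-strict
  4 * (20 * r) ≡⟨ *-assoc 4 20 r ⟨
  80 * r       ≤⟨ *-monoˡ-≤ r (m≤m+n 80 120) ⟩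
  200 * r      <⟨ 200r<k ⟩
  k            ∎
  where
  open ≤-Reasoning

module _ {G : Graph n} {k r : ℕ} (200r<k : 200 * r < k) {K K' : Subset n}
         (W : InFk G k r K) (W' : InFk G k r K') (∣K∖K'∣≤20r : ∣ K ∩ ∁ K' ∣ ≤ 20 * r) where

  ∈A⇒∈A′ : x ∈ K' → x ∈ A W → x ∈ A W'
  ∈A⇒∈A′ x∈K' x∈A with ∈K⇒∈A⊎∈B W' x∈K'
  ... | inj₁ x∈A' = x∈A'
  ... | inj₂ x∈B' = contradiction (degree-bound-violated r k 200r<k) (≤⇒≯ (begin
    3 * k                                ≤⟨ A-degree W _ x∈A ⟩
    20 * ∣ nbhd G K _ ∣                  ≤⟨ *-monoʳ-≤ 20 (∣nbhd-of-B∣≤ W' K x∈B') ⟩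
    20 * (2 * r + ∣ K ∩ ∁ K' ∣)          ≤⟨ *-monoʳ-≤ 20 (+-monoʳ-≤ (2 * r) ∣K∖K'∣≤20r) ⟩
    20 * (2 * r + 20 * r)                ∎))
    where open ≤-Reasoning

module _ {G : Graph n} {k r : ℕ} (200r<k : 200 * r < k) {K K' : Subset n}
         (W : InFk G k r K) (W' : InFk G k r K') (∣K'∖K∣≤20r : ∣ K' ∩ ∁ K ∣ ≤ 20 * r) where

  N' : Fin r → Subset n
  N' i = nbhdSet G K' (pair W' i)

  linked-pairs-differ-outside-K : ∀ {i j l} → u ∈ pair W' i → u ∈ pair W j →
    v ∈ pair W j → v ∈ pair W' l → N' i ∩ ∁ (N' l) ⊆ K' ∩ ∁ K
  linked-pairs-differ-outside-K {u = u} {v} {i} {j} {l} u∈i u∈j v∈j v∈l {x} x∈ with x∈p∩q⁻ (N' i) _ x∈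
  ... | x∈Ni , x∈∁Nl with ∈-nbhdSet⁻ {G = G} x∈Ni
  ...   | x∈K' , y , y∈i , yx = x∈p∩q⁺ (x∈K' , x∉p⇒x∈∁p x∉K)
    where
    x∉K : x ∉ K
    x∉K x∈K = x∈∁p⇒x∉p x∈∁Nl (∈-nbhdSet⁺ {G = G} x∈K' v∈l vx)
      where
      vx = adjacent-to-pair W x∈K u∈j (adjacent-to-pair W' x∈K' y∈i yx u∈i) v∈j

  linked-pairs-equal : ∀ {i j l} → u ∈ pair W' i → u ∈ pair W j →
    v ∈ pair W j → v ∈ pair W' l → i ≡ l
  linked-pairs-equal {i = i} {l = l} u∈i u∈j v∈j v∈l with i Fin.≟ l
  ... | yes i≡l = i≡l
  ... | no  i≢l = contradiction (far-bound-violated r k 200r<k) (≤⇒≯ (begin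
    k                         ≤⟨ pair-far W' i l i≢l ⟩
    4 * ∣ N' i △ N' l ∣       ≤⟨ *-monoʳ-≤ 4 (p⊆q⇒∣p∣≤∣q∣ Ni△Nl⊆K'∖K) ⟩
    4 * ∣ K' ∩ ∁ K ∣          ≤⟨ *-monoʳ-≤ 4 ∣K'∖K∣≤20r ⟩
    4 * (20 * r)              ∎))
    where
    open ≤-Reasoning
    Ni△Nl⊆K'∖K = p∩∁q⊆s⇒q∩∁p⊆s⇒p△q⊆s
      (linked-pairs-differ-outside-K u∈i u∈j v∈j v∈l)
      (linked-pairs-differ-outside-K v∈l v∈j u∈j u∈i)

  IsPair⇒IsPair′ : u ∈ A W' → v ∈ A W' → IsPair W u v → IsPair W' u v
  IsPair⇒IsPair′ {u = u} {v} u∈A' v∈A' (j , pairʲ≡uv) with pair-cover W' u u∈A' | pair-cover W' v v∈A'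
  ... | i , u∈i | l , v∈l =
    i , ∣p∣≡2⇒p≡⁅x⁆∪⁅y⁆ (pair-size W' i) u∈i (subst (λ m → v ∈ pair W' m) (sym i≡l) v∈l) u≢v
    where
    u∈j = subst (u ∈_) (sym pairʲ≡uv) (x∈p∪q⁺ (inj₁ (x∈⁅x⁆ u)))
    v∈j = subst (v ∈_) (sym pairʲ≡uv) (x∈p∪q⁺ (inj₂ (x∈⁅x⁆ v)))
    i≡l = linked-pairs-equal u∈i u∈j v∈j v∈l
    u≢v = ∣⁅x⁆∪⁅y⁆∣≡2⇒x≢y (subst (λ p → ∣ p ∣ ≡ 2) pairʲ≡uv (pair-size W j))

lemma5p3 : ∀ {n : ℕ} (G : Graph n) (k r : ℕ) → 1 ≤ r → 200 * r < k →
    (K K' : Subset n) → ∣ K ∣ ≡ k → ∣ K' ∣ ≡ k →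
    (W : InFk G k r K) (W' : InFk G k r K') →
    k ≤ ∣ K ∩ K' ∣ + 20 * r →
    (∀ v → v ∈ K → v ∈ K' → (v ∈ A W ⇔ v ∈ A W'))
    × (∀ u v → u ∈ A W → u ∈ A W' → v ∈ A W → v ∈ A W' → (IsPair W u v ⇔ IsPair W' u v))
lemma5p3 G k r _ 200r<k K K' ∣K∣≡k ∣K'∣≡k W W' k≤∣K∩K'∣+20r =
  (λ v v∈K v∈K' → mk⇔ (∈A⇒∈A′ 200r<k W W' ∣K∖K'∣≤20r v∈K') (∈A⇒∈A′ 200r<k W' W ∣K'∖K∣≤20r v∈K)) ,
  (λ u v u∈A u∈A' v∈A v∈A' →
    mk⇔ (IsPair⇒IsPair′ 200r<k W W' ∣K'∖K∣≤20r u∈A' v∈A') (IsPair⇒IsPair′ 200r<k W' W ∣K∖K'∣≤20r u∈A v∈A))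
  where
  ∣K∖K'∣≤20r : ∣ K ∩ ∁ K' ∣ ≤ 20 * r
  ∣K∖K'∣≤20r = ∣p∣≤∣p∩q∣+m⇒∣p∩∁q∣≤m K K' (subst (_≤ _) (sym ∣K∣≡k) k≤∣K∩K'∣+20r)
  ∣K'∖K∣≤20r : ∣ K' ∩ ∁ K ∣ ≤ 20 * r
  ∣K'∖K∣≤20r = ∣p∣≤∣p∩q∣+m⇒∣p∩∁q∣≤m K' K (subst (λ m → m ≤ ∣ K' ∩ K ∣ + 20 * r) (sym ∣K'∣≡k)
    (subst (λ s → k ≤ ∣ s ∣ + 20 * r) (∩-comm K K') k≤∣K∩K'∣+20r))
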